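{- Suppose the jobs are indexed so that $d_1\le d_2\le\dots\le d_n$. Let $\sigma$ be a proper schedule of $J$ and let $\sigma'$ be the intermediate schedule obtained from $\sigma$ by an admissible swap (at some step $j^*$ between machines $M_h$ and $M_i$). Then $L_{\max}(\sigma')\le L_{\max}(\sigma)$, where $L_{\max}$ of a schedule is $\max_{j\in J}(C_j-d_j)$ with $C_j$ the completion time of job $j$ in that schedule.
   Context: Setting: $m$ identical parallel machines $M_1,\dots,M_m$ and jobs $J=\{1,\dots,n\}$; job $j$ has positive integer processing time $p_j$ and integer due date $d_j$. Let $p_{\max}=\max_j p_j$; for $J'\subseteq J$ let $P(J')=\sum_{j\in J'}p_j$; let $J_j=\{1,\dots,j\}$. A proper schedule $\sigma$ is a partition $J=J_1(\sigma)\cup\dots\cup J_m(\sigma)$ ($J_i(\sigma)$ = jobs on $M_i$), where each machine processes its jobs from time $0$ without idle time in increasing order of index. Let $J_{i,j}(\sigma)=J_i(\sigma)\cap J_j$. In any schedule, each machine processes its jobs in a given sequence without idle time from time $0$, and $C_j$ is the time job $j$ finishes. The swap: let $\sigma$ be a proper schedule, $j^*\in J$, and $h,i\in\{1,\dots,m\}$. The swap is admissible for $\sigma$ at step $j^*$ (with machines $M_h,M_i$) if (i) $j^*\in J_{h}(\sigma)$; (ii) $|J_i(\sigma)\setminus J_{i,j^*}(\sigma)|\ge 2p_{\max}$; (iii) $P(J_{h,j^*}(\sigma))-P(J_{i,j^*}(\sigma))\ge 4p_{\max}^2$. In that case let $J_I$ be the first $2p_{\max}$ jobs (in processing order on $M_i$)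 of $J_i(\sigma)\setminus J_{i,j^*}(\sigma)$ and $J_H$ the last $2p_{\max}$ jobs (in processing order on $M_h$) of $J_{h,j^*}(\sigma)$. Choose nonempty $J_{H'}\subseteq J_H$ and $J_{I'}\subseteq J_I$ with $P(J_{H'})=P(J_{I'})$, and let $J_{H''}=J_H\setminus J_{H'}$, $J_{I''}=J_I\setminus J_{I'}$. The intermediate schedule $\sigma'$ changes only $M_h$ and $M_i$: on $M_h$ the consecutive block $J_H$ is replaced by the jobs of $J_{H''}$ (in their order in $\sigma$) followed by the jobs of $J_{I'}$ (in their order in $\sigma$); on $M_i$ the consecutive block $J_I$ is replaced by the jobs of $J_{H'}$ (in their order in $\sigma$) followed by the jobs of $J_{I''}$ (in their order in $\sigma$); all other jobs keep their machine and relative order, and machines process jobs without idle time. -}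

module Defs where

open import Data.Bool using (Bool; true; false; not; if_then_else_)
open import Data.Nat as ℕ using (ℕ; zero; suc; _+_; _*_; _∸_; _⊔_)
open import Data.Integer as ℤ using (ℤ; +_; _-_)
open import Data.Fin as Fin using (Fin)
open import Data.List using (List; []; _∷_; _++_; length; take; drop; filter; concatMap; foldr; map)
open import Data.List.Relation.Unary.Linked using (Linked)
open import Data.List.Relation.Binary.Permutation.Propositional using (_↭_)
open import Data.Maybe using (Maybe; just; nothing)
open import Relation.Nullary.Decidable using (does)

-- A schedule of jobs Fin n (job k stands for job k+1 of the paper) on machines
-- Fin m: for each machine, the sequence in which it processes its jobs
-- (from time 0, without idle time).
Schedule : ℕ → ℕ → Set
Schedule n m = Fin m → List (Fin n)

IsPartition : ∀ {n m} → Schedule n m → Set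
IsPartition {n} {m} σ = concatMap σ (Data.List.allFin m) ↭ Data.List.allFin n
  where import Data.List

Proper : ∀ {n m} → Schedule n m → Set
Proper {n} {m} σ = IsPartition σ × (∀ (k : Fin m) → Linked Fin._<_ (σ k))
  where open import Data.Product using (_×_)

P : ∀ {n} → (Fin n → ℕ) → List (Fin n) → ℕ
P p js = foldr (λ j acc → p j + acc) 0 js

pmax : ∀ {n} → (Fin n → ℕ) → ℕ
pmax {n} p = foldr (λ j acc → p j ⊔ acc) 0 (Data.List.allFin n)
  where import Data.List

completionOn : ∀ {n} → (Fin n → ℕ) → List (Fin n) → Fin n → Maybe ℕ
completionOn p [] j = nothing
completionOn p (k ∷ ks) j with does (k Fin.≟ j)
... | true = just (p k)
... | false = Data.Maybe.map (λ c → p k + c) (completionOn p ks j)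
  where import Data.Maybe

firstJust : List (Maybe ℕ) → ℕ
firstJust [] = 0
firstJust (just c ∷ _) = c
firstJust (nothing ∷ xs) = firstJust xs

-- Completion time C_j of job j in schedule σ (the machine containing j is
-- unique for partitions; 0 if j is scheduled nowhere, which never happens
-- for the schedules considered).
C : ∀ {n m} → (Fin n → ℕ) → Schedule n m → Fin n → ℕ
C {n} {m} p σ j = firstJust (map (λ k → completionOn p (σ k) j) (Data.List.allFin m))
  where import Data.List

maxℤ : List ℤ → ℤ
maxℤ [] = + 0
maxℤ (x ∷ []) = x
maxℤ (x ∷ y ∷ ys) = x ℤ.⊔ maxℤ (y ∷ ys)

-- L_max(σ) = max_j (C_j - d_j)   (convention 0 for n = 0, irrelevant here)
Lmax : ∀ {n m} → (Fin n → ℕ) → (Fin n → ℤ) → Schedule n m → ℤ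
Lmax {n} p d σ = maxℤ (map (λ j → + C p σ j - d j) (Data.List.allFin n))
  where import Data.List

select : ∀ {n} → (Fin n → Bool) → List (Fin n) → List (Fin n)
select s [] = []
select s (x ∷ xs) = if s x then x ∷ select s xs else select s xs

unselect : ∀ {n} → (Fin n → Bool) → List (Fin n) → List (Fin n)
unselect s = select (λ x → not (s x))

upTo : ∀ {n m} → Schedule n m → Fin m → Fin n → List (Fin n)
upTo σ k j* = filter (λ x → x Fin.≤? j*) (σ k)

after : ∀ {n m} → Schedule n m → Fin m → Fin n → List (Fin n)
after σ k j* = filter (λ x → j* Fin.<? x) (σ k)

JI : ∀ {n m} → (Fin n → ℕ) → Schedule n m → Fin m → Fin n → List (Fin n)
JI p σ i j* = take (2 * pmax p) (after σ i j*)

JH : ∀ {n m} → (Fin n → ℕ) → Schedule n m → Fin m → Fin n → List (Fin n)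
JH p σ h j* = drop (length (upTo σ h j*) ∸ 2 * pmax p) (upTo σ h j*)

Admissible : ∀ {n m} → (Fin n → ℕ) → Schedule n m → Fin n → Fin m → Fin m → Set
Admissible p σ j* h i =
    (j* ∈ σ h)
  × (2 * pmax p ℕ.≤ length (after σ i j*))
  × (P p (upTo σ i j*) + 4 * (pmax p * pmax p) ℕ.≤ P p (upTo σ h j*))
  where
  open import Data.Product using (_×_)
  open import Data.List.Membership.Propositional using (_∈_)

-- The intermediate schedule σ'.  selH / selI are characteristic functions:
-- J_{H'} = selected part of J_H, J_{H''} = the rest (order kept); same for I.
-- (σ proper, so M_h runs  (J_{h,j*} minus J_H) ++ J_H ++ (after j*), and
--  M_i runs  J_{i,j*} ++ J_I ++ (rest after J_I).)
intermediate : ∀ {n m} → (Fin n → ℕ) → Schedule n m → Fin n → Fin m → Fin m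
             → (Fin n → Bool) → (Fin n → Bool) → Schedule n m
intermediate p σ j* h i selH selI k with does (k Fin.≟ h) | does (k Fin.≟ i)
... | true | _ =
  take (length (upTo σ h j*) ∸ 2 * pmax p) (upTo σ h j*)
  ++ unselect selH (JH p σ h j*)
  ++ select selI (JI p σ i j*)
  ++ after σ h j*
... | false | true =
  upTo σ i j*
  ++ select selH (JH p σ h j*)
  ++ unselect selI (JI p σ i j*)
  ++ drop (2 * pmax p) (after σ i j*)
... | false | false = σ k

{-# OPTIONS --safe #-}

-- Only M_h and M_i change, and on each a block is replaced by one of equal processing time
-- (P(J_H'') + P(J_I') = P(J_H) and P(J_H') + P(J_I'') = P(J_I)), so the jobs before and after
-- the block keep their completion times. A job of J_H'' only loses predecessors. A job of J_I'
-- or J_I'' has index > j*, hence due date ≥ d_j*, and finishes by C_j* = P(J_{h,j*}): on M_h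
-- because the new block weighs P(J_H), on M_i because a block of 2 p_max jobs weighs at most
-- 2 p_max² and P(J_{i,j*}) + 4 p_max² ≤ P(J_{h,j*}). The same inequality makes a job of J_H'
-- finish on M_i before J_H starts on M_h, so earlier than in σ.
module Submission where

open import Defs
open import Data.Bool using (Bool; not)
open import Data.Empty using (⊥-elim)
open import Data.Fin as Fin using (Fin)
import Data.Fin.Properties as Finₚ
open import Data.Integer as ℤ using (ℤ)
import Data.Integer.Properties as ℤₚ
open import Data.List using (List; []; _∷_; _++_; length; take; drop; filter; map; allFin; concatMap; foldr)
open import Data.List.Properties
  using (++-assoc; take++drop≡id; length-take; length-drop; filter-accept; filter-reject; filter-none; filter-all)
open import Data.List.Membership.Propositional using (_∈_; _∉_)
open import Data.List.Membership.Propositional.Properties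
  using (∈-++⁺ˡ; ∈-concat⁺′; ∈-map⁺; ∈-allFin; ∈-filter⁺)
open import Data.List.Relation.Binary.Disjoint.Propositional using (Disjoint)
open import Data.List.Relation.Binary.Permutation.Propositional using (↭-sym; ↭⇒↭ₛ)
import Data.List.Relation.Binary.Permutation.Setoid.Properties as Permutationₛ
open import Data.List.Relation.Unary.All as All using (All; []; _∷_)
import Data.List.Relation.Unary.All.Properties as Allₚ
open import Data.List.Relation.Unary.AllPairs as AllPairs using (AllPairs; []; _∷_)
import Data.List.Relation.Unary.AllPairs.Properties as AllPairsₚ
open import Data.List.Relation.Unary.Any using (here; there)
open import Data.List.Relation.Unary.Linked.Properties using (Linked⇒AllPairs)
open import Data.List.Relation.Unary.Unique.Propositional using (Unique)
open import Data.List.Relation.Unary.Unique.Propositional.Properties using (allFin⁺)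
open import Data.Maybe as Maybe using (Maybe; just; nothing)
import Data.Maybe.Properties as Maybeₚ
open import Data.Nat using (ℕ; _+_; _*_; _∸_; _⊔_; _≤_; _<_; z≤n)
open import Data.Nat.Properties
open import Algebra.Properties.CommutativeSemigroup +-commutativeSemigroup using (x∙yz≈y∙xz)
open import Data.Product using (∃; _×_; _,_; proj₁; proj₂)
open import Data.Sum using (_⊎_; inj₁; inj₂; [_,_]′)
open import Function using (_∘_)
open import Relation.Nullary using (yes; no)
open import Relation.Binary.PropositionalEquality
  using (_≡_; _≢_; refl; sym; trans; cong; cong₂; subst; setoid; module ≡-Reasoning)

module _ {a r} {A : Set a} {R : A → A → Set r} where

  AllPairs-++⁻ : ∀ xs {ys} → AllPairs R (xs ++ ys) →
                 AllPairs R xs × AllPairs R ys × (∀ {x y} → x ∈ xs → y ∈ ys → R x y)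
  AllPairs-++⁻ []       rs        = [] , rs , λ ()
  AllPairs-++⁻ (x ∷ xs) (rx ∷ rs) with AllPairs-++⁻ xs rs
  ... | rxs , rys , cross = Allₚ.++⁻ˡ xs rx ∷ rxs , rys , λ where
    (here refl)  y∈ys → All.lookup (Allₚ.++⁻ʳ xs rx) y∈ys
    (there x∈xs) y∈ys → cross x∈xs y∈ys

module _ {a} {A : Set a} where

  Unique-++⁻ʳ : ∀ (xs : List A) {ys} → Unique (xs ++ ys) → Unique ys
  Unique-++⁻ʳ xs u = proj₁ (proj₂ (AllPairs-++⁻ xs u))

  Unique-++⇒Disjoint : ∀ (xs : List A) {ys} → Unique (xs ++ ys) → Disjoint xs ys
  Unique-++⇒Disjoint xs u (v∈xs , v∈ys) = proj₂ (proj₂ (AllPairs-++⁻ xs u)) v∈xs v∈ys refl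

  Unique-concatMap⇒≡ : ∀ {b} {B : Set b} (f : B → List A) ks → Unique (concatMap f ks) →
                       ∀ {k k′ x} → k ∈ ks → k′ ∈ ks → x ∈ f k → x ∈ f k′ → k ≡ k′
  Unique-concatMap⇒≡ f (k ∷ ks) u (here refl) (here refl) _ _ = refl
  Unique-concatMap⇒≡ f (k ∷ ks) u (here refl) (there k′∈ks) x∈ x∈′ =
    ⊥-elim (Unique-++⇒Disjoint (f k) u (x∈ , ∈-concat⁺′ x∈′ (∈-map⁺ f k′∈ks)))
  Unique-concatMap⇒≡ f (k ∷ ks) u (there k∈ks) (here refl) x∈ x∈′ =
    ⊥-elim (Unique-++⇒Disjoint (f k) u (x∈′ , ∈-concat⁺′ x∈ (∈-map⁺ f k∈ks)))
  Unique-concatMap⇒≡ f (k ∷ ks) u (there k∈ks) (there k′∈ks) x∈ x∈′ =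
    Unique-concatMap⇒≡ f ks (Unique-++⁻ʳ (f k) u) k∈ks k′∈ks x∈ x∈′

∈-select⁻ : ∀ {n} (s : Fin n → Bool) L {x} → x ∈ select s L → x ∈ L
∈-select⁻ s (k ∷ L) x∈ with s k | x∈
... | Bool.true  | here refl  = here refl
... | Bool.true  | there x∈′ = there (∈-select⁻ s L x∈′)
... | Bool.false | x∈′        = there (∈-select⁻ s L x∈′)

module _ {a} {A : Set a} where

  length-take≤ : ∀ k (xs : List A) → length (take k xs) ≤ k
  length-take≤ k xs = subst (_≤ k) (sym (length-take k xs)) (m⊓n≤m k (length xs))

  length-drop-∸≤ : ∀ k (xs : List A) → length (drop (length xs ∸ k) xs) ≤ k
  length-drop-∸≤ k xs = subst (_≤ k) (sym (length-drop (length xs ∸ k) xs))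
    (m≤n+o⇒m∸n≤o (length xs) (length xs ∸ k) (subst (length xs ≤_) (+-comm k _) (m≤n+m∸n (length xs) k)))

filter≤++filter>≡id : ∀ {n} (t : Fin n) {xs : List (Fin n)} → AllPairs Fin._<_ xs →
  filter (λ x → x Fin.≤? t) xs ++ filter (λ x → t Fin.<? x) xs ≡ xs
filter≤++filter>≡id t {[]} _ = refl
filter≤++filter>≡id t {x ∷ xs} (x<xs ∷ sorted) with x Fin.≤? t
... | yes x≤t = begin
  filter (λ y → y Fin.≤? t) (x ∷ xs) ++ filter (λ y → t Fin.<? y) (x ∷ xs)
    ≡⟨ cong₂ _++_ (filter-accept (λ y → y Fin.≤? t) x≤t) (filter-reject (λ y → t Fin.<? y) (≤⇒≯ x≤t)) ⟩
  x ∷ (filter (λ y → y Fin.≤? t) xs ++ filter (λ y → t Fin.<? y) xs)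
    ≡⟨ cong (x ∷_) (filter≤++filter>≡id t sorted) ⟩
  x ∷ xs ∎
  where open ≡-Reasoning
... | no x≰t = cong₂ _++_ (filter-none (λ y → y Fin.≤? t) (All.map <⇒≱ t<x∷xs))
                          (filter-all (λ y → t Fin.<? y) t<x∷xs)
  where
  t<x∷xs : All (λ y → t Fin.< y) (x ∷ xs)
  t<x∷xs = ≰⇒> x≰t ∷ All.map (<-trans (≰⇒> x≰t)) x<xs

map-just⁻ : ∀ {a b} {A : Set a} {B : Set b} {f : A → B} (mx : Maybe A) {y} →
            Maybe.map f mx ≡ just y → ∃ λ x → mx ≡ just x × f x ≡ y
map-just⁻ (just x) refl = x , refl , refl

module _ {n : ℕ} (p : Fin n → ℕ) where

  completionOn-head : ∀ j L → completionOn p (j ∷ L) j ≡ just (p j)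
  completionOn-head j L with j Fin.≟ j
  ... | yes _   = refl
  ... | no j≢j = ⊥-elim (j≢j refl)

  completionOn-tail : ∀ {k j} L → k ≢ j → completionOn p (k ∷ L) j ≡ Maybe.map (p k +_) (completionOn p L j)
  completionOn-tail {k} {j} L k≢j with k Fin.≟ j
  ... | yes k≡j = ⊥-elim (k≢j k≡j)
  ... | no _    = refl

  completionOn-there : ∀ {k j c} L → k ≢ j → completionOn p L j ≡ just c →
                       completionOn p (k ∷ L) j ≡ just (p k + c)
  completionOn-there L k≢j e = trans (completionOn-tail L k≢j) (Maybeₚ.map-just e)

  completionOn-∷⁻ : ∀ {k j c} L → completionOn p (k ∷ L) j ≡ just c →
    (k ≡ j × p k ≡ c) ⊎ (k ≢ j × ∃ λ c′ → completionOn p L j ≡ just c′ × p k + c′ ≡ c)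
  completionOn-∷⁻ {k} {j} L e with k Fin.≟ j
  ... | yes k≡j = inj₁ (k≡j , Maybeₚ.just-injective e)
  ... | no k≢j  = inj₂ (k≢j , map-just⁻ (completionOn p L j) e)

  completionOn-∈ : ∀ L {j c} → completionOn p L j ≡ just c → j ∈ L
  completionOn-∈ (k ∷ L) {j} e with completionOn-∷⁻ {k} {j} L e
  ... | inj₁ (refl , _)          = here refl
  ... | inj₂ (_ , _ , e′ , _) = there (completionOn-∈ L e′)

  completionOn≤P : ∀ L {j c} → completionOn p L j ≡ just c → c ≤ P p L
  completionOn≤P (k ∷ L) {j} e with completionOn-∷⁻ {k} {j} L e
  ... | inj₁ (_ , refl)          = m≤m+n (p k) (P p L)
  ... | inj₂ (_ , _ , e′ , refl) = +-monoʳ-≤ (p k) (completionOn≤P L e′)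

  completionOn-++ˡ : ∀ X Y {j c} → completionOn p X j ≡ just c → completionOn p (X ++ Y) j ≡ just c
  completionOn-++ˡ (k ∷ X) Y {j} e with completionOn-∷⁻ {k} {j} X e
  ... | inj₁ (refl , refl)          = completionOn-head k (X ++ Y)
  ... | inj₂ (k≢j , _ , e′ , refl) = completionOn-there (X ++ Y) k≢j (completionOn-++ˡ X Y e′)

  completionOn-++ʳ : ∀ X {Y j} → j ∉ X →
                     completionOn p (X ++ Y) j ≡ Maybe.map (P p X +_) (completionOn p Y j)
  completionOn-++ʳ []      {Y} {j} _  = sym (Maybeₚ.map-id (completionOn p Y j))
  completionOn-++ʳ (k ∷ X) {Y} {j} j∉ = begin
    completionOn p (k ∷ X ++ Y) j
      ≡⟨ completionOn-tail (X ++ Y) (λ k≡j → j∉ (here (sym k≡j))) ⟩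
    Maybe.map (p k +_) (completionOn p (X ++ Y) j)
      ≡⟨ cong (Maybe.map (p k +_)) (completionOn-++ʳ X (j∉ ∘ there)) ⟩
    Maybe.map (p k +_) (Maybe.map (P p X +_) (completionOn p Y j))
      ≡⟨ Maybeₚ.map-∘ (completionOn p Y j) ⟨
    Maybe.map (λ c → p k + (P p X + c)) (completionOn p Y j)
      ≡⟨ Maybeₚ.map-cong (λ c → +-assoc (p k) (P p X) c) (completionOn p Y j) ⟨
    Maybe.map (P p (k ∷ X) +_) (completionOn p Y j) ∎
    where open ≡-Reasoning

  completionOn-++ʳ-just : ∀ X {Y j c} → j ∉ X → completionOn p Y j ≡ just c →
                          completionOn p (X ++ Y) j ≡ just (P p X + c)
  completionOn-++ʳ-just X j∉X e = trans (completionOn-++ʳ X j∉X) (Maybeₚ.map-just e)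

  completionOn-++⁻ : ∀ X {Y j c} → completionOn p (X ++ Y) j ≡ just c →
    completionOn p X j ≡ just c ⊎ (j ∉ X × ∃ λ c′ → completionOn p Y j ≡ just c′ × P p X + c′ ≡ c)
  completionOn-++⁻ []      e = inj₂ ((λ ()) , _ , e , refl)
  completionOn-++⁻ (k ∷ X) {Y} {j} e with completionOn-∷⁻ {k} {j} (X ++ Y) e
  ... | inj₁ (refl , refl) = inj₁ (completionOn-head k X)
  ... | inj₂ (k≢j , _ , e′ , refl) with completionOn-++⁻ X e′
  ...   | inj₁ eX                  = inj₁ (completionOn-there X k≢j eX)
  ...   | inj₂ (j∉X , c′ , eY , refl) = inj₂ (j∉k∷X , c′ , eY , +-assoc (p k) (P p X) c′)
    where
    j∉k∷X : _ ∉ k ∷ X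
    j∉k∷X (here j≡k)  = k≢j (sym j≡k)
    j∉k∷X (there j∈X) = j∉X j∈X

  completionOn-replace : ∀ X {B B′ Y j c} → P p B′ ≡ P p B → Disjoint B Y →
    completionOn p (X ++ B′ ++ Y) j ≡ just c →
    completionOn p (X ++ B ++ Y) j ≡ just c ⊎ (j ∉ X × ∃ λ c′ → completionOn p B′ j ≡ just c′ × P p X + c′ ≡ c)
  completionOn-replace X {B} {B′} {Y} P[B′]≡P[B] disjoint e with completionOn-++⁻ X e
  ... | inj₁ eX = inj₁ (completionOn-++ˡ X (B ++ Y) eX)
  ... | inj₂ (j∉X , c′ , e′ , refl) with completionOn-++⁻ B′ e′
  ...   | inj₁ eB′                 = inj₂ (j∉X , c′ , eB′ , refl)
  ...   | inj₂ (_ , c″ , eY , refl) rewrite P[B′]≡P[B] =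
    inj₁ (completionOn-++ʳ-just X j∉X (completionOn-++ʳ-just B (λ j∈B → disjoint (j∈B , completionOn-∈ Y eY)) eY))

  completionOn-select : ∀ s L {j c} → Unique L → completionOn p (select s L) j ≡ just c →
                        ∃ λ c′ → completionOn p L j ≡ just c′ × c ≤ c′
  completionOn-select s (k ∷ L) {j} (k∉L ∷ uL) e with s k
  ... | Bool.false with completionOn-select s L uL e
  ...   | c′ , e′ , c≤c′ = p k + c′ , completionOn-there L k≢j e′ , ≤-trans c≤c′ (m≤n+m c′ (p k))
    where
    k≢j : k ≢ j
    k≢j = All.lookup k∉L (completionOn-∈ L e′)
  completionOn-select s (k ∷ L) {j} (k∉L ∷ uL) e | Bool.true with completionOn-∷⁻ {k} {j} (select s L) e
  ... | inj₁ (refl , refl) = p k , completionOn-head k L , ≤-refl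
  ... | inj₂ (k≢j , _ , e′ , refl) with completionOn-select s L uL e′
  ...   | c′ , e″ , le = p k + c′ , completionOn-there L k≢j e″ , +-monoʳ-≤ (p k) le

  completionOn-last : ∀ L {j} → AllPairs Fin._<_ L → All (λ k → k Fin.≤ j) L → j ∈ L →
                      completionOn p L j ≡ just (P p L)
  completionOn-last (k ∷ []) _ _ (here refl) =
    trans (completionOn-head k []) (cong just (sym (+-identityʳ (p k))))
  completionOn-last (k ∷ k′ ∷ L) ((k<k′ ∷ _) ∷ _) (_ ∷ k′≤k ∷ _) (here refl) =
    ⊥-elim (<-irrefl refl (<-≤-trans k<k′ k′≤k))
  completionOn-last (k ∷ L) (k<L ∷ sorted) (_ ∷ L≤j) (there j∈L) =
    completionOn-there L (Finₚ.<⇒≢ (All.lookup k<L j∈L)) (completionOn-last L sorted L≤j j∈L)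

  P-++ : ∀ X Y → P p (X ++ Y) ≡ P p X + P p Y
  P-++ []      Y = refl
  P-++ (k ∷ X) Y = trans (cong (p k +_) (P-++ X Y)) (sym (+-assoc (p k) (P p X) (P p Y)))

  P-select+P-unselect : ∀ s L → P p (select s L) + P p (unselect s L) ≡ P p L
  P-select+P-unselect s []      = refl
  P-select+P-unselect s (k ∷ L) with s k
  ... | Bool.true  = trans (+-assoc (p k) _ _) (cong (p k +_) (P-select+P-unselect s L))
  ... | Bool.false = trans (x∙yz≈y∙xz (P p (select s L)) (p k) (P p (unselect s L)))
                           (cong (p k +_) (P-select+P-unselect s L))

  p≤pmax : ∀ j → p j ≤ pmax p
  p≤pmax j = p≤foldr⊔ (allFin n) (∈-allFin j)
    where
    p≤foldr⊔ : ∀ xs {x} → x ∈ xs → p x ≤ foldr (λ k acc → p k ⊔ acc) 0 xs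
    p≤foldr⊔ (y ∷ xs) (here refl) = m≤m⊔n (p y) _
    p≤foldr⊔ (y ∷ xs) (there x∈)  = ≤-trans (p≤foldr⊔ xs x∈) (m≤n⊔m (p y) _)

  P≤length*pmax : ∀ L → P p L ≤ length L * pmax p
  P≤length*pmax []      = z≤n
  P≤length*pmax (k ∷ L) = +-mono-≤ (p≤pmax k) (P≤length*pmax L)

module _ {a} {A : Set a} (F : A → Maybe ℕ) where

  firstJust-map-cases : ∀ xs → firstJust (map F xs) ≡ 0 ⊎ ∃ λ x → F x ≡ just (firstJust (map F xs))
  firstJust-map-cases []       = inj₁ refl
  firstJust-map-cases (x ∷ xs) with F x in e
  ... | just _  = inj₂ (x , e)
  ... | nothing = firstJust-map-cases xs

  firstJust-map-unique : ∀ xs {x c} → x ∈ xs → F x ≡ just c →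
                         (∀ y {c′} → F y ≡ just c′ → c′ ≡ c) → firstJust (map F xs) ≡ c
  firstJust-map-unique (y ∷ xs) (here refl) e _ rewrite e = refl
  firstJust-map-unique (y ∷ xs) (there x∈xs) e only with F y in e′
  ... | just _  = only y e′
  ... | nothing = firstJust-map-unique xs x∈xs e only

IsPartition⇒Unique : ∀ {n m} (σ : Schedule n m) → IsPartition σ → Unique (concatMap σ (allFin m))
IsPartition⇒Unique {n} σ partition =
  Permutationₛ.Unique-resp-↭ (setoid (Fin n)) (↭⇒↭ₛ (↭-sym partition)) (allFin⁺ n)

module _ {n m : ℕ} (p : Fin n → ℕ) (σ : Schedule n m) where

  C-completionOn : IsPartition σ → ∀ {k j c} → completionOn p (σ k) j ≡ just c → C p σ j ≡ c
  C-completionOn partition {k} {j} e =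
    firstJust-map-unique (λ k → completionOn p (σ k) j) (allFin m) (∈-allFin k) e only
    where
    only : ∀ k′ {c′} → completionOn p (σ k′) j ≡ just c′ → c′ ≡ _
    only k′ e′ with Unique-concatMap⇒≡ σ (allFin m) (IsPartition⇒Unique σ partition)
                      (∈-allFin k) (∈-allFin k′) (completionOn-∈ p (σ k) e) (completionOn-∈ p (σ k′) e′)
    ... | refl = Maybeₚ.just-injective (trans (sym e′) e)

  C-cases : ∀ j → C p σ j ≡ 0 ⊎ ∃ λ k → completionOn p (σ k) j ≡ just (C p σ j)
  C-cases j = firstJust-map-cases (λ k → completionOn p (σ k) j) (allFin m)

maxℤ-upper : ∀ xs {x} → x ∈ xs → x ℤ.≤ maxℤ xs
maxℤ-upper (x ∷ [])     (here refl) = ℤₚ.≤-refl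
maxℤ-upper (x ∷ y ∷ ys) (here refl) = ℤₚ.i≤i⊔j x _
maxℤ-upper (x ∷ y ∷ ys) (there x∈) = ℤₚ.≤-trans (maxℤ-upper (y ∷ ys) x∈) (ℤₚ.i≤j⊔i x _)

maxℤ-least : ∀ x xs {u} → All (ℤ._≤ u) (x ∷ xs) → maxℤ (x ∷ xs) ℤ.≤ u
maxℤ-least x []       (x≤u ∷ []) = x≤u
maxℤ-least x (y ∷ ys) (x≤u ∷ ≤u) = ℤₚ.⊔-lub x≤u (maxℤ-least y ys ≤u)

maxℤ-map-mono : ∀ {a} {A : Set a} (f g : A → ℤ) xs → (∀ x → ∃ λ y → y ∈ xs × f x ℤ.≤ g y) →
                maxℤ (map f xs) ℤ.≤ maxℤ (map g xs)
maxℤ-map-mono f g []       _         = ℤₚ.≤-refl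
maxℤ-map-mono f g (x ∷ xs) dominated =
  maxℤ-least (f x) (map f xs) (Allₚ.map⁺ (All.universal bound (x ∷ xs)))
  where
  bound : ∀ z → f z ℤ.≤ maxℤ (map g (x ∷ xs))
  bound z with dominated z
  ... | y , y∈ , fz≤gy = ℤₚ.≤-trans fz≤gy (maxℤ-upper (map g (x ∷ xs)) (∈-map⁺ g y∈))

Lmax-mono : ∀ {n m} (p : Fin n → ℕ) (d : Fin n → ℤ) (σ′ σ : Schedule n m) →
            (∀ j → ∃ λ j′ → ℤ.+ C p σ′ j ℤ.- d j ℤ.≤ ℤ.+ C p σ j′ ℤ.- d j′) →
            Lmax p d σ′ ℤ.≤ Lmax p d σ
Lmax-mono p d σ′ σ dominated =
  maxℤ-map-mono _ _ (allFin _) (λ j → let j′ , le = dominated j in j′ , ∈-allFin j′ , le)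

lateness-mono : ∀ {a b : ℕ} {e f : ℤ} → a ≤ b → e ℤ.≤ f → ℤ.+ a ℤ.- f ℤ.≤ ℤ.+ b ℤ.- e
lateness-mono a≤b e≤f = ℤₚ.+-mono-≤ (ℤ.+≤+ a≤b) (ℤₚ.neg-mono-≤ e≤f)

module Swap {n m : ℕ} (p : Fin n → ℕ) (σ : Schedule n m) (proper : Proper σ)
            (j* : Fin n) (h i : Fin m) (admissible : Admissible p σ j* h i)
            (selH selI : Fin n → Bool)
            (balanced : P p (select selH (JH p σ h j*)) ≡ P p (select selI (JI p σ i j*)))
            (p[j*]>0 : 0 < p j*) where

  pm K B : ℕ
  pm = pmax p
  K  = 2 * pm
  B  = 2 * (pm * pm)

  -- U = J_{h,j*} = A ++ J_H, V = J_h ∖ J_{h,j*}, W = J_{i,j*}, X = J_i ∖ J_{i,j*} = J_I ++ R.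
  U V W X A H I R H′ H″ I′ I″ : List (Fin n)
  U  = upTo σ h j*
  V  = after σ h j*
  W  = upTo σ i j*
  X  = after σ i j*
  A  = take (length U ∸ K) U
  H  = JH p σ h j*
  I  = JI p σ i j*
  R  = drop K X
  H′ = select selH H
  H″ = unselect selH H
  I′ = select selI I
  I″ = unselect selI I

  σ′ : Schedule n m
  σ′ = intermediate p σ j* h i selH selI

  sorted : ∀ k → AllPairs Fin._<_ (σ k)
  sorted k = Linked⇒AllPairs Finₚ.<-trans (proj₂ proper k)

  C-via : ∀ {k L j c} → σ k ≡ L → completionOn p L j ≡ just c → C p σ j ≡ c
  C-via refl = C-completionOn p σ (proj₁ proper)

  σh≡ : σ h ≡ A ++ H ++ V
  σh≡ = begin
    σ h            ≡⟨ filter≤++filter>≡id j* (sorted h) ⟨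
    U ++ V         ≡⟨ cong (_++ V) (take++drop≡id (length U ∸ K) U) ⟨
    (A ++ H) ++ V  ≡⟨ ++-assoc A H V ⟩
    A ++ H ++ V    ∎
    where open ≡-Reasoning

  σi≡ : σ i ≡ W ++ I ++ R
  σi≡ = begin
    σ i          ≡⟨ filter≤++filter>≡id j* (sorted i) ⟨
    W ++ X       ≡⟨ cong (W ++_) (take++drop≡id K X) ⟨
    W ++ I ++ R  ∎
    where open ≡-Reasoning

  σh-unique : Unique (A ++ H ++ V)
  σh-unique = subst Unique σh≡ (AllPairs.map Finₚ.<⇒≢ (sorted h))

  H-unique : Unique H
  H-unique = proj₁ (AllPairs-++⁻ H (Unique-++⁻ʳ A σh-unique))

  A∩HV : Disjoint A (H ++ V)
  A∩HV = Unique-++⇒Disjoint A σh-unique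

  H∩V : Disjoint H V
  H∩V = Unique-++⇒Disjoint H (Unique-++⁻ʳ A σh-unique)

  I∩R : Disjoint I R
  I∩R = Unique-++⇒Disjoint I (Unique-++⁻ʳ W (subst Unique σi≡ (AllPairs.map Finₚ.<⇒≢ (sorted i))))

  I-after-j* : All (λ x → j* Fin.< x) I
  I-after-j* = Allₚ.take⁺ K (Allₚ.all-filter (λ x → j* Fin.<? x) (σ i))

  C[j*]≡P[U] : C p σ j* ≡ P p U
  C[j*]≡P[U] = C-via (sym (filter≤++filter>≡id j* (sorted h))) (completionOn-++ˡ p U V
    (completionOn-last p U (AllPairsₚ.filter⁺ (λ x → x Fin.≤? j*) (sorted h))
       (Allₚ.all-filter (λ x → x Fin.≤? j*) (σ h))
       (∈-filter⁺ (λ x → x Fin.≤? j*) (proj₁ admissible) (Finₚ.≤-refl {x = j*}))))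

  P-block≤B : ∀ L → length L ≤ K → P p L ≤ B
  P-block≤B L |L|≤K = begin
    P p L             ≤⟨ P≤length*pmax p L ⟩
    length L * pm     ≤⟨ *-monoˡ-≤ pm |L|≤K ⟩
    2 * pm * pm       ≡⟨ *-assoc 2 pm pm ⟩
    B                 ∎
    where open ≤-Reasoning

  P[H]≤B : P p H ≤ B
  P[H]≤B = P-block≤B H (length-drop-∸≤ K U)

  P[I]≤B : P p I ≤ B
  P[I]≤B = P-block≤B I (length-take≤ K X)

  P[A]+P[H]≡P[U] : P p A + P p H ≡ P p U
  P[A]+P[H]≡P[U] = trans (sym (P-++ p A H)) (cong (P p) (take++drop≡id (length U ∸ K) U))

  P[H″++I′]≡P[H] : P p (H″ ++ I′) ≡ P p H
  P[H″++I′]≡P[H] = begin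
    P p (H″ ++ I′)    ≡⟨ P-++ p H″ I′ ⟩
    P p H″ + P p I′   ≡⟨ cong (P p H″ +_) balanced ⟨
    P p H″ + P p H′   ≡⟨ +-comm (P p H″) (P p H′) ⟩
    P p H′ + P p H″   ≡⟨ P-select+P-unselect p selH H ⟩
    P p H             ∎
    where open ≡-Reasoning

  P[H′++I″]≡P[I] : P p (H′ ++ I″) ≡ P p I
  P[H′++I″]≡P[I] = begin
    P p (H′ ++ I″)    ≡⟨ P-++ p H′ I″ ⟩
    P p H′ + P p I″   ≡⟨ cong (_+ P p I″) balanced ⟩
    P p I′ + P p I″   ≡⟨ P-select+P-unselect p selI I ⟩
    P p I             ∎
    where open ≡-Reasoning

  gap : P p W + (B + B) ≤ P p U
  gap = subst (λ x → P p W + x ≤ P p U) (*-distribʳ-+ (pm * pm) 2 2) (proj₂ (proj₂ admissible))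

  P[W]+c≤P[U] : ∀ {c} → c ≤ B → P p W + c ≤ P p U
  P[W]+c≤P[U] c≤B = ≤-trans (+-monoʳ-≤ (P p W) (≤-trans c≤B (m≤m+n B B))) gap

  P[W]+c≤P[A] : ∀ {c} → c ≤ B → P p W + c ≤ P p A
  P[W]+c≤P[A] {c} c≤B = +-cancelʳ-≤ B (P p W + c) (P p A) (begin
    P p W + c + B      ≤⟨ +-monoˡ-≤ B (+-monoʳ-≤ (P p W) c≤B) ⟩
    P p W + B + B      ≡⟨ +-assoc (P p W) B B ⟩
    P p W + (B + B)    ≤⟨ gap ⟩
    P p U              ≡⟨ P[A]+P[H]≡P[U] ⟨
    P p A + P p H      ≤⟨ +-monoʳ-≤ (P p A) P[H]≤B ⟩
    P p A + B          ∎)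
    where open ≤-Reasoning

  h≢i : h ≢ i
  h≢i refl = <-irrefl refl (<-≤-trans (m<m+n (P p U) (≤-trans B>0 (m≤m+n B B))) gap)
    where
    pm>0 : 0 < pm
    pm>0 = <-≤-trans p[j*]>0 (p≤pmax p j*)
    B>0 : 0 < B
    B>0 = ≤-trans (*-mono-≤ pm>0 pm>0) (m≤m+n (pm * pm) _)

  σ′h≡ : σ′ h ≡ A ++ (H″ ++ I′) ++ V
  σ′h≡ with h Fin.≟ h
  ... | yes _   = cong (A ++_) (sym (++-assoc H″ I′ V))
  ... | no h≢h = ⊥-elim (h≢h refl)

  σ′i≡ : σ′ i ≡ W ++ (H′ ++ I″) ++ R
  σ′i≡ with i Fin.≟ h | i Fin.≟ i
  ... | yes i≡h | _       = ⊥-elim (h≢i (sym i≡h))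
  ... | no _    | yes _   = cong (W ++_) (sym (++-assoc H′ I″ R))
  ... | no _    | no i≢i = ⊥-elim (i≢i refl)

  σ′k≡ : ∀ {k} → k ≢ h → k ≢ i → σ′ k ≡ σ k
  σ′k≡ {k} k≢h k≢i with k Fin.≟ h | k Fin.≟ i
  ... | yes k≡h | _       = ⊥-elim (k≢h k≡h)
  ... | no _    | yes k≡i = ⊥-elim (k≢i k≡i)
  ... | no _    | no _    = refl

  Dominated : ℕ → Fin n → Set
  Dominated c j = c ≤ C p σ j ⊎ (j* Fin.< j × c ≤ C p σ j*)

  completion-in-H : ∀ s {j c} → completionOn p (select s H) j ≡ just c → P p A + c ≤ C p σ j
  completion-in-H s e with completionOn-select p s H H-unique e
  ... | c′ , eH , c≤c′ =
    subst (P p A + _ ≤_) (sym (C-via σh≡ (completionOn-++ʳ-just p A j∉A (completionOn-++ˡ p H V eH))))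
          (+-monoʳ-≤ (P p A) c≤c′)
    where
    j∉A : _ ∉ A
    j∉A j∈A = A∩HV (j∈A , ∈-++⁺ˡ (completionOn-∈ p H eH))

  after-j* : ∀ s {j c} → completionOn p (select s I) j ≡ just c → j* Fin.< j
  after-j* s e = All.lookup I-after-j* (∈-select⁻ s I (completionOn-∈ p (select s I) e))

  middle-h≤C[j*] : ∀ {j c} → completionOn p (H″ ++ I′) j ≡ just c → P p A + c ≤ C p σ j*
  middle-h≤C[j*] {c = c} e = begin
    P p A + c               ≤⟨ +-monoʳ-≤ (P p A) (completionOn≤P p (H″ ++ I′) e) ⟩
    P p A + P p (H″ ++ I′)  ≡⟨ cong (P p A +_) P[H″++I′]≡P[H] ⟩
    P p A + P p H           ≡⟨ P[A]+P[H]≡P[U] ⟩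
    P p U                   ≡⟨ C[j*]≡P[U] ⟨
    C p σ j*                ∎
    where open ≤-Reasoning

  middle-i≤B : ∀ {j c} → completionOn p (H′ ++ I″) j ≡ just c → c ≤ B
  middle-i≤B e = ≤-trans (completionOn≤P p (H′ ++ I″) e) (subst (_≤ B) (sym P[H′++I″]≡P[I]) P[I]≤B)

  machine-h : ∀ {j c} → completionOn p (σ′ h) j ≡ just c → Dominated c j
  machine-h e with completionOn-replace p A P[H″++I′]≡P[H] H∩V
                     (subst (λ L → completionOn p L _ ≡ just _) σ′h≡ e)
  ... | inj₁ eσ = inj₁ (≤-reflexive (sym (C-via σh≡ eσ)))
  ... | inj₂ (_ , _ , e′ , refl) with completionOn-++⁻ p H″ e′
  ...   | inj₁ eH″              = inj₁ (completion-in-H (not ∘ selH) eH″)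
  ...   | inj₂ (_ , _ , eI′ , _) = inj₂ (after-j* selI eI′ , middle-h≤C[j*] e′)

  machine-i : ∀ {j c} → completionOn p (σ′ i) j ≡ just c → Dominated c j
  machine-i e with completionOn-replace p W P[H′++I″]≡P[I] I∩R
                     (subst (λ L → completionOn p L _ ≡ just _) σ′i≡ e)
  ... | inj₁ eσ = inj₁ (≤-reflexive (sym (C-via σi≡ eσ)))
  ... | inj₂ (_ , c′ , e′ , refl) with completionOn-++⁻ p H′ e′
  ...   | inj₁ eH′ =
    inj₁ (≤-trans (P[W]+c≤P[A] (middle-i≤B e′)) (≤-trans (m≤m+n (P p A) c′) (completion-in-H selH eH′)))
  ...   | inj₂ (_ , _ , eI″ , _) =
    inj₂ (after-j* (not ∘ selI) eI″ , subst (P p W + c′ ≤_) (sym C[j*]≡P[U]) (P[W]+c≤P[U] (middle-i≤B e′)))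

  which-machine : ∀ k → k ≡ h ⊎ k ≡ i ⊎ (k ≢ h × k ≢ i)
  which-machine k with k Fin.≟ h | k Fin.≟ i
  ... | yes k≡h | _       = inj₁ k≡h
  ... | no _    | yes k≡i = inj₂ (inj₁ k≡i)
  ... | no k≢h  | no k≢i  = inj₂ (inj₂ (k≢h , k≢i))

  completion-dominated : ∀ j → Dominated (C p σ′ j) j
  completion-dominated j with C-cases p σ′ j
  -- σ′ is not shown to be a partition; a job missing from it would get C = 0.
  ... | inj₁ C′≡0 = inj₁ (subst (_≤ C p σ j) (sym C′≡0) z≤n)
  ... | inj₂ (k , e) with which-machine k
  ...   | inj₁ refl              = machine-h e
  ...   | inj₂ (inj₁ refl)       = machine-i e
  ...   | inj₂ (inj₂ (k≢h , k≢i)) = inj₁ (≤-reflexive (sym (C-via (sym (σ′k≡ k≢h k≢i)) e)))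

lemma7 : (n m : ℕ) (p : Fin n → ℕ) (d : Fin n → ℤ)
    → (∀ j → 0 < p j)
    → (∀ j k → j Fin.≤ k → d j ℤ.≤ d k)
    → (σ : Schedule n m) → Proper σ
    → (j* : Fin n) (h i : Fin m) → Admissible p σ j* h i
    → (selH selI : Fin n → Bool)
    → select selH (JH p σ h j*) ≢ []
    → select selI (JI p σ i j*) ≢ []
    → P p (select selH (JH p σ h j*)) ≡ P p (select selI (JI p σ i j*))
    → Lmax p d (intermediate p σ j* h i selH selI) ℤ.≤ Lmax p d σ
lemma7 n m p d p>0 d-mono σ proper j* h i admissible selH selI _ _ balanced =
  Lmax-mono p d σ′ σ λ j → [ (λ C′≤C → j , lateness-mono C′≤C (ℤₚ.≤-refl {d j}))
                           , (λ (j*<j , C′≤C[j*]) → j* , lateness-mono C′≤C[j*] (d-mono j* j (<⇒≤ j*<j)))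
                           ]′ (completion-dominated j)
  where
  open Swap p σ proper j* h i admissible selH selI balanced (p>0 j*)
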